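{- Let $k$ be a positive integer and $H=(V,\mathcal{E})$ a hypergraph. For a $k$-coloring $c$ let $\phi(c)=\sum_{e\in\mathcal{E}}|c(e)|$. Then $\phi$ is a potential function for the game in which every vertex is conflict-free seeking: for any two $k$-colorings $c,c'$ that differ only at a single vertex $v$, $\phi(c)-\phi(c')=u_v(c)-u_v(c')$.
   Context: A hypergraph is a pair $H=(V,\mathcal{E})$ with $V$ a finite set and $\mathcal{E}$ a collection of non-empty subsets of $V$. A $k$-coloring is a function $c:V\to\{1,\dots,k\}$, and for $S\subseteq V$, $c(S)$ denotes the set of colors used on $S$. With $\mathcal{E}(v)=\{e\in\mathcal{E}: v\in e\}$, the utility of a conflict-free seeking vertex $v$ is $u_v(c)=|\{e\in\mathcal{E}(v): |c(e)|=|c(e\setminus\{v\})|+1\}|$. -}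

module Defs where

open import Data.Nat using (ℕ; zero; suc; _+_; _≟_)
open import Data.Bool using (Bool; false; _∧_; _∨_)
open import Data.Fin using (Fin)
import Data.Fin as F
open import Data.Fin.Subset using (Subset; ∣_∣; _─_; ⁅_⁆; _∈_; Nonempty)
open import Data.Fin.Subset.Properties using (_∈?_)
open import Data.Vec using (tabulate; lookup)
open import Data.List using (List; length; filter; map)
open import Data.Nat.ListAction using (sum)
open import Data.List.Relation.Unary.All using (All)
open import Data.Product using (_×_)
open import Relation.Nullary.Decidable using (⌊_⌋; _×-dec_)

record Hypergraph (n : ℕ) : Set where
  field
    edges    : List (Subset n)
    nonempty : All Nonempty edges
open Hypergraph public

Coloring : ℕ → ℕ → Set
Coloring n k = Fin n → Fin k

anyFin : ∀ {n} → (Fin n → Bool) → Bool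
anyFin {zero}  f = false
anyFin {suc n} f = f F.zero ∨ anyFin (λ i → f (F.suc i))

colorsOn : ∀ {n k} → Coloring n k → Subset n → Subset k
colorsOn c S = tabulate (λ i → anyFin (λ v → lookup S v ∧ ⌊ c v F.≟ i ⌋))

numColors : ∀ {n k} → Coloring n k → Subset n → ℕ
numColors c S = ∣ colorsOn c S ∣

φ : ∀ {n k} → Hypergraph n → Coloring n k → ℕ
φ H c = sum (map (numColors c) (edges H))

utility : ∀ {n k} → Hypergraph n → Fin n → Coloring n k → ℕ
utility H v c =
  length (filter (λ e → (v ∈? e) ×-dec (numColors c e ≟ numColors c (e ─ ⁅ v ⁆) + 1)) (edges H))

-- When v changes colour, only the edges containing v change their number of colours, and for
-- such an edge e both |c(e)| and |c′(e)| lie in {m, m + 1}, where m = |c(e ∖ {v})| = |c′(e ∖ {v})|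
-- does not depend on the colour of v; the value m + 1 is attained exactly when e contributes to
-- the utility of v. Hence |c(e)| - |c′(e)| equals the difference of the contributions of e to
-- u_v(c) and u_v(c′), and summing over the edges gives the claim.
module Submission where

open import Defs
open import Algebra.Bundles using (CommutativeMonoid)
import Algebra.Properties.CommutativeSemigroup as CommutativeSemigroupProperties
open import Data.Bool using (Bool; true; false; _∧_; _∨_)
open import Data.Bool.Properties using (∨-identityʳ; ∧-distribʳ-∨; ∨-commutativeMonoid)
open import Data.Fin using (Fin; zero; suc)
open import Data.Fin.Properties using (_≟_)
open import Data.Fin.Subset using (Subset; outside; inside; ∣_∣; ⁅_⁆; _∪_; _─_; _∈_; _∉_; _⊆_)
open import Data.Fin.Subset.Properties
  using (⊆-antisym; ∪-identityʳ; x∈⁅x⁆; x∈⁅y⁆⇒x≡y; x∈p∪q⁺; x∈p∪q⁻; x∈p∧x≢y⇒x∈p-y; p─q⊆p; _∈?_)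
open import Data.Integer using (+_; _-_; _⊖_)
open import Data.Integer.Properties using (m-n≡m⊖n; +-cancelˡ-⊖)
open import Data.List using (List; []; _∷_; length; filter; map)
open import Data.List.Properties using (map-cong)
open import Data.Nat using (ℕ; zero; suc; _+_; _≤_; z<s) renaming (_≟_ to _≟ℕ_)
open import Data.Nat.ListAction using (sum)
open import Data.Nat.Properties using (+-comm; +-identityʳ; +-commutativeSemigroup; <⇒≢; m<m+n)
open import Data.Product using (_×_)
open import Data.Sum as Sum using (_⊎_; inj₁; inj₂)
open import Data.Vec using (_∷_; lookup; tabulate; there)
open import Data.Vec.Properties
  using (lookup∘tabulate; tabulate∘lookup; tabulate-cong; lookup-zipWith; lookup-replicate; lookup⇒[]=)
open import Function using (_∘_)
open import Relation.Binary.PropositionalEquality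
  using (_≡_; _≢_; refl; sym; trans; cong; cong₂; module ≡-Reasoning)
open import Relation.Nullary using (Dec; does; yes; no)
open import Relation.Nullary.Decidable using (⌊_⌋; _×-dec_; isYes≗does; dec-true; dec-false)
open import Relation.Unary using (Pred; Decidable)

∨-interchange : ∀ a b c d → (a ∨ b) ∨ (c ∨ d) ≡ (a ∨ c) ∨ (b ∨ d)
∨-interchange =
  CommutativeSemigroupProperties.interchange (CommutativeMonoid.commutativeSemigroup ∨-commutativeMonoid)

+-interchange : ∀ a b c d → (a + b) + (c + d) ≡ (a + c) + (b + d)
+-interchange = CommutativeSemigroupProperties.interchange +-commutativeSemigroup

anyFin-cong : ∀ {n} {f g : Fin n → Bool} → (∀ w → f w ≡ g w) → anyFin f ≡ anyFin g
anyFin-cong {zero}  f≗g = refl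
anyFin-cong {suc n} f≗g = cong₂ _∨_ (f≗g zero) (anyFin-cong (f≗g ∘ suc))

anyFin-false : ∀ n → anyFin {n} (λ _ → false) ≡ false
anyFin-false zero    = refl
anyFin-false (suc n) = anyFin-false n

anyFin-∨ : ∀ {n} (f g : Fin n → Bool) → anyFin (λ w → f w ∨ g w) ≡ anyFin f ∨ anyFin g
anyFin-∨ {zero}  f g = refl
anyFin-∨ {suc n} f g = trans (cong ((f zero ∨ g zero) ∨_) (anyFin-∨ (f ∘ suc) (g ∘ suc)))
                               (∨-interchange (f zero) (g zero) (anyFin (f ∘ suc)) (anyFin (g ∘ suc)))

anyFin-at : ∀ {n} (v : Fin n) (b : Fin n → Bool) → anyFin (λ w → does (v ≟ w) ∧ b w) ≡ b v
anyFin-at {suc n} zero    b = trans (cong (b zero ∨_) (anyFin-false n)) (∨-identityʳ (b zero))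
anyFin-at {suc n} (suc v) b = anyFin-at v (b ∘ suc)

lookup-⁅⁆ : ∀ {n} (x i : Fin n) → lookup ⁅ x ⁆ i ≡ does (x ≟ i)
lookup-⁅⁆ zero    zero    = refl
lookup-⁅⁆ zero    (suc i) = lookup-replicate i outside
lookup-⁅⁆ (suc x) zero    = refl
lookup-⁅⁆ (suc x) (suc i) = lookup-⁅⁆ x i

⁅⁆-tabulate : ∀ {n} (x : Fin n) → ⁅ x ⁆ ≡ tabulate (λ i → does (x ≟ i))
⁅⁆-tabulate x = trans (sym (tabulate∘lookup ⁅ x ⁆)) (tabulate-cong (lookup-⁅⁆ x))

x∉p─⁅x⁆ : ∀ {n} {x : Fin n} (p : Subset n) → x ∉ p ─ ⁅ x ⁆
x∉p─⁅x⁆ {x = suc x} (_ ∷ p) (there x∈) = x∉p─⁅x⁆ p x∈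

x∈p⇒[p─⁅x⁆]∪⁅x⁆≡p : ∀ {n} {x : Fin n} {p : Subset n} → x ∈ p → (p ─ ⁅ x ⁆) ∪ ⁅ x ⁆ ≡ p
x∈p⇒[p─⁅x⁆]∪⁅x⁆≡p {x = x} {p} x∈p = ⊆-antisym ⊆p p⊆
  where
  ⊆p : (p ─ ⁅ x ⁆) ∪ ⁅ x ⁆ ⊆ p
  ⊆p {y} y∈ with x∈p∪q⁻ (p ─ ⁅ x ⁆) ⁅ x ⁆ y∈
  ... | inj₁ y∈p─⁅x⁆ = p─q⊆p p ⁅ x ⁆ y∈p─⁅x⁆
  ... | inj₂ y∈⁅x⁆ with refl ← x∈⁅y⁆⇒x≡y x y∈⁅x⁆ = x∈p
  p⊆ : p ⊆ (p ─ ⁅ x ⁆) ∪ ⁅ x ⁆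
  p⊆ {y} y∈p with y ≟ x
  ... | yes refl = x∈p∪q⁺ (inj₂ (x∈⁅x⁆ x))
  ... | no y≢x   = x∈p∪q⁺ (inj₁ (x∈p∧x≢y⇒x∈p-y y∈p y≢x))

∣p∪⁅x⁆∣≡∣p∣⊎∣p∣+1 : ∀ {n} (p : Subset n) (x : Fin n) →
                     ∣ p ∪ ⁅ x ⁆ ∣ ≡ ∣ p ∣ ⊎ ∣ p ∪ ⁅ x ⁆ ∣ ≡ ∣ p ∣ + 1
∣p∪⁅x⁆∣≡∣p∣⊎∣p∣+1 (inside  ∷ p) zero rewrite ∪-identityʳ p = inj₁ refl
∣p∪⁅x⁆∣≡∣p∣⊎∣p∣+1 (outside ∷ p) zero rewrite ∪-identityʳ p = inj₂ (+-comm 1 ∣ p ∣)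
∣p∪⁅x⁆∣≡∣p∣⊎∣p∣+1 (inside  ∷ p) (suc x) = Sum.map (cong suc) (cong suc) (∣p∪⁅x⁆∣≡∣p∣⊎∣p∣+1 p x)
∣p∪⁅x⁆∣≡∣p∣⊎∣p∣+1 (outside ∷ p) (suc x) = ∣p∪⁅x⁆∣≡∣p∣⊎∣p∣+1 p x

module _ {n k : ℕ} where

  colorsOn-cong : {c c′ : Coloring n k} (S : Subset n) → (∀ {w} → w ∈ S → c w ≡ c′ w) →
                  colorsOn c S ≡ colorsOn c′ S
  colorsOn-cong {c} {c′} S c≗c′ = tabulate-cong (λ i → anyFin-cong (λ w → agreeAt w i))
    where
    agreeAt : ∀ w i → lookup S w ∧ ⌊ c w ≟ i ⌋ ≡ lookup S w ∧ ⌊ c′ w ≟ i ⌋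
    agreeAt w i with lookup S w in w∈S
    ... | true  = cong (λ color → ⌊ color ≟ i ⌋) (c≗c′ (lookup⇒[]= w S w∈S))
    ... | false = refl

  colorsOn-∪ : (c : Coloring n k) (p q : Subset n) →
               colorsOn c (p ∪ q) ≡ colorsOn c p ∪ colorsOn c q
  colorsOn-∪ c p q = begin
    colorsOn c (p ∪ q)
      ≡⟨ tabulate-cong colorsAt-∪ ⟩
    tabulate (λ i → lookup (colorsOn c p) i ∨ lookup (colorsOn c q) i)
      ≡⟨ tabulate-cong (λ i → lookup-zipWith _∨_ i (colorsOn c p) (colorsOn c q)) ⟨
    tabulate (lookup (colorsOn c p ∪ colorsOn c q))
      ≡⟨ tabulate∘lookup _ ⟩
    colorsOn c p ∪ colorsOn c q
      ∎
    where
    open ≡-Reasoning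
    colorsAt-∪ : ∀ i → anyFin (λ w → lookup (p ∪ q) w ∧ ⌊ c w ≟ i ⌋)
                     ≡ lookup (colorsOn c p) i ∨ lookup (colorsOn c q) i
    colorsAt-∪ i = begin
      anyFin (λ w → lookup (p ∪ q) w ∧ ⌊ c w ≟ i ⌋)
        ≡⟨ anyFin-cong (λ w → trans (cong (_∧ ⌊ c w ≟ i ⌋) (lookup-zipWith _∨_ w p q))
                                    (∧-distribʳ-∨ ⌊ c w ≟ i ⌋ (lookup p w) (lookup q w))) ⟩
      anyFin (λ w → (lookup p w ∧ ⌊ c w ≟ i ⌋) ∨ (lookup q w ∧ ⌊ c w ≟ i ⌋))
        ≡⟨ anyFin-∨ (λ w → lookup p w ∧ ⌊ c w ≟ i ⌋) (λ w → lookup q w ∧ ⌊ c w ≟ i ⌋) ⟩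
      anyFin (λ w → lookup p w ∧ ⌊ c w ≟ i ⌋) ∨ anyFin (λ w → lookup q w ∧ ⌊ c w ≟ i ⌋)
        ≡⟨ cong₂ _∨_ (lookup∘tabulate _ i) (lookup∘tabulate _ i) ⟨
      lookup (colorsOn c p) i ∨ lookup (colorsOn c q) i ∎

  colorsOn-⁅⁆ : (c : Coloring n k) (v : Fin n) → colorsOn c ⁅ v ⁆ ≡ ⁅ c v ⁆
  colorsOn-⁅⁆ c v = trans (tabulate-cong colorAt) (sym (⁅⁆-tabulate (c v)))
    where
    colorAt : ∀ i → anyFin (λ w → lookup ⁅ v ⁆ w ∧ ⌊ c w ≟ i ⌋) ≡ does (c v ≟ i)
    colorAt i = trans (anyFin-cong (λ w → cong₂ _∧_ (lookup-⁅⁆ v w) (isYes≗does (c w ≟ i))))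
                      (anyFin-at v (λ w → does (c w ≟ i)))

  colorsOn-─⁅⁆∪⁅⁆ : (c : Coloring n k) {v : Fin n} {e : Subset n} → v ∈ e →
                   colorsOn c e ≡ colorsOn c (e ─ ⁅ v ⁆) ∪ ⁅ c v ⁆
  colorsOn-─⁅⁆∪⁅⁆ c {v} {e} v∈e = begin
    colorsOn c e                                   ≡⟨ cong (colorsOn c) (sym (x∈p⇒[p─⁅x⁆]∪⁅x⁆≡p v∈e)) ⟩
    colorsOn c ((e ─ ⁅ v ⁆) ∪ ⁅ v ⁆)               ≡⟨ colorsOn-∪ c (e ─ ⁅ v ⁆) ⁅ v ⁆ ⟩
    colorsOn c (e ─ ⁅ v ⁆) ∪ colorsOn c ⁅ v ⁆      ≡⟨ cong (colorsOn c (e ─ ⁅ v ⁆) ∪_) (colorsOn-⁅⁆ c v) ⟩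
    colorsOn c (e ─ ⁅ v ⁆) ∪ ⁅ c v ⁆               ∎
    where open ≡-Reasoning

  numColors-dichotomy : (c : Coloring n k) {v : Fin n} {e : Subset n} → v ∈ e →
                        numColors c e ≡ numColors c (e ─ ⁅ v ⁆)
                        ⊎ numColors c e ≡ numColors c (e ─ ⁅ v ⁆) + 1
  numColors-dichotomy c {v} {e} v∈e rewrite colorsOn-─⁅⁆∪⁅⁆ c v∈e =
    ∣p∪⁅x⁆∣≡∣p∣⊎∣p∣+1 (colorsOn c (e ─ ⁅ v ⁆)) (c v)

indicator : Bool → ℕ
indicator true  = 1
indicator false = 0

module _ {a} {A : Set a} where

  length-filter≡sum-indicator : ∀ {p} {P : Pred A p} (P? : Decidable P) (xs : List A) →
                                length (filter P? xs) ≡ sum (map (indicator ∘ does ∘ P?) xs)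
  length-filter≡sum-indicator P? []       = refl
  length-filter≡sum-indicator P? (x ∷ xs) with does (P? x)
  ... | true  = cong suc (length-filter≡sum-indicator P? xs)
  ... | false = length-filter≡sum-indicator P? xs

  sum-map-+ : (f g : A → ℕ) (xs : List A) →
              sum (map (λ x → f x + g x) xs) ≡ sum (map f xs) + sum (map g xs)
  sum-map-+ f g []       = refl
  sum-map-+ f g (x ∷ xs) = trans (cong (_+_ (f x + g x)) (sum-map-+ f g xs))
                                 (+-interchange (f x) (g x) (sum (map f xs)) (sum (map g xs)))

+-indicator-swap : ∀ {m m′ a a′} → m ≡ m′ → a ≡ m ⊎ a ≡ m + 1 → a′ ≡ m′ ⊎ a′ ≡ m′ + 1 →
                   a + indicator (does (a′ ≟ℕ m′ + 1)) ≡ a′ + indicator (does (a ≟ℕ m + 1))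
+-indicator-swap             refl (inj₁ refl) (inj₁ refl) = refl
+-indicator-swap             refl (inj₂ refl) (inj₂ refl) = refl
+-indicator-swap {m} {a = a} refl (inj₁ refl) (inj₂ refl)
  rewrite dec-true (m + 1 ≟ℕ m + 1) refl | dec-false (a ≟ℕ m + 1) (<⇒≢ (m<m+n m z<s))
  = sym (+-identityʳ (m + 1))
+-indicator-swap {m} {a′ = a′} refl (inj₂ refl) (inj₁ refl)
  rewrite dec-true (m + 1 ≟ℕ m + 1) refl | dec-false (a′ ≟ℕ m + 1) (<⇒≢ (m<m+n m z<s))
  = +-identityʳ (m + 1)

m+q≡n+p⇒+m-+n≡+p-+q : ∀ m n p q → m + q ≡ n + p → + m - + n ≡ + p - + q
m+q≡n+p⇒+m-+n≡+p-+q m n p q m+q≡n+p = begin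
  + m - + n              ≡⟨ m-n≡m⊖n m n ⟩
  m ⊖ n                  ≡⟨ +-cancelˡ-⊖ q m n ⟨
  (q + m) ⊖ (q + n)      ≡⟨ cong₂ _⊖_ (trans (+-comm q m) m+q≡n+p) (+-comm q n) ⟩
  (n + p) ⊖ (n + q)      ≡⟨ +-cancelˡ-⊖ n p q ⟩
  p ⊖ q                  ≡⟨ m-n≡m⊖n p q ⟨
  + p - + q              ∎
  where open ≡-Reasoning

-- utility H v c unfolds to length (filter (uniquelyColored? c v) (edges H)).
uniquelyColored? : ∀ {n k} (c : Coloring n k) (v : Fin n) (e : Subset n) →
                   Dec (v ∈ e × numColors c e ≡ numColors c (e ─ ⁅ v ⁆) + 1)
uniquelyColored? c v e = (v ∈? e) ×-dec (numColors c e ≟ℕ numColors c (e ─ ⁅ v ⁆) + 1)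

module _ {n k : ℕ} {c c′ : Coloring n k} {v : Fin n} (c≗c′ : ∀ w → w ≢ v → c w ≡ c′ w) where

  numColors-cong : (S : Subset n) → v ∉ S → numColors c S ≡ numColors c′ S
  numColors-cong S v∉S = cong ∣_∣ (colorsOn-cong S (λ {w} w∈S → c≗c′ w (λ { refl → v∉S w∈S })))

  contribution : Coloring n k → Subset n → ℕ
  contribution d e = indicator (does (uniquelyColored? d v e))

  numColors+contribution-swap : (e : Subset n) →
                                numColors c e + contribution c′ e ≡ numColors c′ e + contribution c e
  numColors+contribution-swap e with v ∈? e
  ... | no  v∉e = cong (_+ 0) (numColors-cong e v∉e)
  ... | yes v∈e = +-indicator-swap (numColors-cong (e ─ ⁅ v ⁆) (x∉p─⁅x⁆ e))
                                   (numColors-dichotomy c v∈e) (numColors-dichotomy c′ v∈e)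

  φ+utility-swap : (H : Hypergraph n) → φ H c + utility H v c′ ≡ φ H c′ + utility H v c
  φ+utility-swap H = begin
    φ H c + utility H v c′
      ≡⟨ cong (_+_ (φ H c)) (length-filter≡sum-indicator (uniquelyColored? c′ v) (edges H)) ⟩
    φ H c + sum (map (contribution c′) (edges H))
      ≡⟨ sum-map-+ (numColors c) (contribution c′) (edges H) ⟨
    sum (map (λ e → numColors c e + contribution c′ e) (edges H))
      ≡⟨ cong sum (map-cong numColors+contribution-swap (edges H)) ⟩
    sum (map (λ e → numColors c′ e + contribution c e) (edges H))
      ≡⟨ sum-map-+ (numColors c′) (contribution c) (edges H) ⟩
    φ H c′ + sum (map (contribution c) (edges H))
      ≡⟨ cong (_+_ (φ H c′)) (length-filter≡sum-indicator (uniquelyColored? c v) (edges H)) ⟨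
    φ H c′ + utility H v c
      ∎
    where open ≡-Reasoning

claim2 : (k n : ℕ) → 1 ≤ k → (H : Hypergraph n) → (c c′ : Coloring n k) → (v : Fin n)
         → (∀ w → w ≢ v → c w ≡ c′ w)
         → (+ φ H c) - (+ φ H c′) ≡ (+ utility H v c) - (+ utility H v c′)
claim2 k n _ H c c′ v c≗c′ =
  m+q≡n+p⇒+m-+n≡+p-+q (φ H c) (φ H c′) (utility H v c) (utility H v c′) (φ+utility-swap c≗c′ H)
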